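{- For an integer $h\geq 1$ let $\Gamma_{3^h}$ denote the multiplicative circulant graph $MC(3^h)$, and let $\Gamma_{3^0}$ denote the one-vertex graph. Let $h$ be a positive integer. Then $$d_{\Gamma_{3^h}}(0,j)=\begin{cases} d_{\Gamma_{3^{h-1}}}(0,j) & \text{if } j=0,1,2,\ldots,\tfrac{3^{h-1}-1}{2},\\ d_{\Gamma_{3^{h-1}}}(0,j)+1 & \text{if } j=\tfrac{3^{h-1}-1}{2}+1,\ldots,3^{h-1}-1.\end{cases}$$ Moreover, if $k\in V(\Gamma_{3^h})$ is such that $k=3^{h-1}+j$ for some $j\in\{0,1,\ldots,\frac{3^{h-1}-1}{2}\}$, then $$d_{\Gamma_{3^h}}(0,k)=d_{\Gamma_{3^{h-1}}}(0,j)+1.$$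
   Context: For integers $m>1$, $h>0$, $MC(m^h)$ is the graph with vertex set $\mathbb{Z}_{m^h}$ in which distinct vertices $x,y$ are adjacent iff $x-y\equiv \pm m^i \pmod{m^h}$ for some $i\in\{0,\ldots,h-1\}$. $d_\Gamma(u,v)$ is the length of a shortest path between $u$ and $v$ in $\Gamma$. An integer $j$ used as a vertex of $\Gamma_{3^{k}}$ is identified with its residue modulo $3^{k}$. -}

module Defs where

open import Data.Nat using (ℕ; zero; suc; _+_; _*_; _^_; _≤_; _<_)
open import Data.Product using (Σ; ∃-syntax; _×_)
open import Data.Sum using (_⊎_)
open import Relation.Binary.PropositionalEquality using (_≡_)
open import Relation.Nullary using (¬_)

_≡_[mod_] : ℕ → ℕ → ℕ → Set
x ≡ y [mod n ] = ∃[ k ] (x ≡ y + k * n ⊎ y ≡ x + k * n)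

-- Adjacency in MC(m^h): vertices are residues mod m^h (represented by
-- natural numbers, identified modulo m^h); distinct x, y are adjacent iff
-- x - y ≡ ± m^i (mod m^h) for some i ∈ {0, …, h-1}.
Adj : (m h : ℕ) → ℕ → ℕ → Set
Adj m h x y =
  ¬ (x ≡ y [mod m ^ h ]) ×
  ∃[ i ] (i < h × (x ≡ y + m ^ i [mod m ^ h ] ⊎ y ≡ x + m ^ i [mod m ^ h ]))

data Walk (m h : ℕ) : ℕ → ℕ → ℕ → Set where
  here : ∀ {u v} → u ≡ v [mod m ^ h ] → Walk m h u v 0
  step : ∀ {u w v ℓ} → Adj m h u w → Walk m h w v ℓ → Walk m h u v (suc ℓ)

IsDist : (m h : ℕ) → ℕ → ℕ → ℕ → Set
IsDist m h u v d = Walk m h u v d × (∀ ℓ → Walk m h u v ℓ → d ≤ ℓ)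

-- The distance d(0, x) in MC(3^h) is the weight of x: the number of nonzero
-- digits in the h-digit balanced ternary expansion (digits −1, 0, 1) of x
-- modulo 3^h.  Adding ±3^i changes the weight by at most one and the weight
-- is 3^h-periodic, so no walk from 0 to x is shorter than the weight; on the
-- other hand multiplying a walk by 3 gives a walk in MC(3^(h+1)), and one more
-- unit step fixes the last digit, so a walk of that length exists.  The theorem
-- compares expansions with h − 1 and h digits: they agree for
-- j ≤ (3^(h−1) − 1)/2 = 11…1₃, and for larger j, as for 3^(h−1) + j, the
-- expansion with h digits acquires the leading digit 1.
module Submission where

open import Defs
open import Data.Nat using (ℕ; zero; suc; _+_; _*_; _∸_; _^_; _≤_; _<_; _/_; _%_; NonZero; z≤n; s≤s)
open import Data.Nat.Properties
open import Data.Nat.DivMod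
open import Data.Nat.Divisibility using (divides-refl)
open import Data.Nat.Tactic.RingSolver using (solve-∀)
open import Data.Product using (∃-syntax; _×_; _,_; proj₂)
open import Data.Sum using (_⊎_; inj₁; inj₂)
open import Relation.Binary.PropositionalEquality
open import Relation.Nullary using (¬_)

≡mod-refl : ∀ {x y n} → x ≡ y → x ≡ y [mod n ]
≡mod-refl {y = y} refl = 0 , inj₁ (sym (+-identityʳ y))

≡mod-sym : ∀ {x y n} → x ≡ y [mod n ] → y ≡ x [mod n ]
≡mod-sym (k , inj₁ e) = k , inj₂ e
≡mod-sym (k , inj₂ e) = k , inj₁ e

≡mod⇒%≡ : ∀ {x y} n .{{_ : NonZero n}} → x ≡ y [mod n ] → x % n ≡ y % n
≡mod⇒%≡ {y = y} n (k , inj₁ refl) = [m+kn]%n≡m%n y k n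
≡mod⇒%≡ {x = x} n (k , inj₂ refl) = sym ([m+kn]%n≡m%n x k n)

%≡∧/≤⇒≡mod : ∀ x y n .{{_ : NonZero n}} → x % n ≡ y % n → x / n ≤ y / n → x ≡ y [mod n ]
%≡∧/≤⇒≡mod x y n x%n≡y%n x/n≤y/n = y / n ∸ x / n , inj₂ (begin
  y                                         ≡⟨ m≡m%n+[m/n]*n y n ⟩
  y % n + y / n * n                         ≡⟨ cong₂ _+_ (sym x%n≡y%n) (cong (_* n) (sym (m+[n∸m]≡n x/n≤y/n))) ⟩
  x % n + (x / n + (y / n ∸ x / n)) * n     ≡⟨ regroup (x % n) (x / n) (y / n ∸ x / n) n ⟩
  (x % n + x / n * n) + (y / n ∸ x / n) * n ≡⟨ cong (_+ (y / n ∸ x / n) * n) (m≡m%n+[m/n]*n x n) ⟨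
  x + (y / n ∸ x / n) * n                   ∎)
  where
  open ≡-Reasoning
  regroup : ∀ a b d n → a + (b + d) * n ≡ (a + b * n) + d * n
  regroup = solve-∀

%≡⇒≡mod : ∀ x y n .{{_ : NonZero n}} → x % n ≡ y % n → x ≡ y [mod n ]
%≡⇒≡mod x y n x%n≡y%n with ≤-total (x / n) (y / n)
... | inj₁ x/n≤y/n = %≡∧/≤⇒≡mod x y n x%n≡y%n x/n≤y/n
... | inj₂ y/n≤x/n = ≡mod-sym (%≡∧/≤⇒≡mod y x n (sym x%n≡y%n) y/n≤x/n)

≡mod-trans : ∀ {x y z} n .{{_ : NonZero n}} → x ≡ y [mod n ] → y ≡ z [mod n ] → x ≡ z [mod n ]
≡mod-trans {x} {y} {z} n x≡y y≡z = %≡⇒≡mod x z n (trans (≡mod⇒%≡ n x≡y) (≡mod⇒%≡ n y≡z))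

+-congʳ-≡mod : ∀ {x y} n c .{{_ : NonZero n}} → x ≡ y [mod n ] → (x + c) ≡ y + c [mod n ]
+-congʳ-≡mod {x} {y} n c x≡y = %≡⇒≡mod (x + c) (y + c) n (begin
  (x + c) % n           ≡⟨ %-distribˡ-+ x c n ⟩
  (x % n + c % n) % n   ≡⟨ cong (λ r → (r + c % n) % n) (≡mod⇒%≡ n x≡y) ⟩
  (y % n + c % n) % n   ≡⟨ %-distribˡ-+ y c n ⟨
  (y + c) % n           ∎)
  where open ≡-Reasoning

*3-distrib : ∀ y k n → (y + k * n) * 3 ≡ y * 3 + k * (3 * n)
*3-distrib = solve-∀

*3-cong-≡mod : ∀ {x y n} → x ≡ y [mod n ] → (x * 3) ≡ y * 3 [mod 3 * n ]
*3-cong-≡mod {y = y} {n = n} (k , inj₁ refl) = k , inj₁ (*3-distrib y k n)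
*3-cong-≡mod {x = x} {n = n} (k , inj₂ refl) = k , inj₂ (*3-distrib x k n)

*3-cancel-≡mod : ∀ {x y n} → (x * 3) ≡ y * 3 [mod 3 * n ] → x ≡ y [mod n ]
*3-cancel-≡mod {x} {y} {n} (k , inj₁ e) = k , inj₁ (*-cancelʳ-≡ x (y + k * n) 3 (trans e (sym (*3-distrib y k n))))
*3-cancel-≡mod {x} {y} {n} (k , inj₂ e) = k , inj₂ (*-cancelʳ-≡ y (x + k * n) 3 (trans e (sym (*3-distrib x k n))))

suc≢mod : ∀ {u n} → 2 ≤ n → ¬ (suc u ≡ u [mod n ])
suc≢mod {u} {n} 2≤n (k , inj₁ e) = <⇒≢ 2≤n (sym (m*n≡1⇒n≡1 k n (sym 1≡k*n)))
  where
  1≡k*n : 1 ≡ k * n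
  1≡k*n = +-cancelˡ-≡ u 1 (k * n) (trans (+-comm u 1) e)
suc≢mod {u} _ (k , inj₂ e) = 1+n≰n (≤-trans (m≤m+n (suc u) _) (≤-reflexive (sym e)))

data Ternary : ℕ → Set where
  0+3* : ∀ q → Ternary (q * 3)
  1+3* : ∀ q → Ternary (1 + q * 3)
  2+3* : ∀ q → Ternary (2 + q * 3)

ternary : ∀ x → Ternary x
ternary zero = 0+3* 0
ternary (suc x) with ternary x
... | 0+3* q = 1+3* q
... | 1+3* q = 2+3* q
... | 2+3* q = 0+3* (suc q)

[r+q*3]%3≡r : ∀ r q → r < 3 → (r + q * 3) % 3 ≡ r
[r+q*3]%3≡r r q r<3 = trans ([m+kn]%n≡m%n r q 3) (m<n⇒m%n≡m r<3)

[r+q*3]/3≡q : ∀ r q → r < 3 → (r + q * 3) / 3 ≡ q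
[r+q*3]/3≡q r q r<3 = begin
  (r + q * 3) / 3   ≡⟨ +-distrib-/-∣ʳ r (divides-refl q) ⟩
  r / 3 + q * 3 / 3 ≡⟨ cong₂ _+_ (m<n⇒m/n≡0 r<3) (m*n/n≡m q 3) ⟩
  q                 ∎
  where open ≡-Reasoning

quotient-mono : ∀ r a b → r + a * 3 ≤ 2 + b * 3 → a ≤ b
quotient-mono r a b le = ≤-pred (*-cancelʳ-< 3 a (suc b) (s≤s (≤-trans (m≤n+m (a * 3) r) le)))

mutual
  weight : ℕ → ℕ → ℕ
  weight zero    x = 0
  weight (suc h) x = digitWeight h (x % 3) (x / 3)

  -- A last digit 2 is written as −1 with a carry into q.
  digitWeight : ℕ → ℕ → ℕ → ℕ
  digitWeight h zero          q = weight h q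
  digitWeight h (suc zero)    q = suc (weight h q)
  digitWeight h (suc (suc _)) q = suc (weight h (suc q))

weight-digits : ∀ h r q {x} → x ≡ r + q * 3 → r < 3 → weight (suc h) x ≡ digitWeight h r q
weight-digits h r q refl r<3 rewrite [r+q*3]%3≡r r q r<3 | [r+q*3]/3≡q r q r<3 = refl

weight-0+3* : ∀ h q {x} → x ≡ q * 3 → weight (suc h) x ≡ weight h q
weight-0+3* h q x≡ = weight-digits h 0 q x≡ (s≤s z≤n)

weight-1+3* : ∀ h q {x} → x ≡ 1 + q * 3 → weight (suc h) x ≡ suc (weight h q)
weight-1+3* h q x≡ = weight-digits h 1 q x≡ (s≤s (s≤s z≤n))

weight-2+3* : ∀ h q {x} → x ≡ 2 + q * 3 → weight (suc h) x ≡ suc (weight h (suc q))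
weight-2+3* h q x≡ = weight-digits h 2 q x≡ (s≤s (s≤s (s≤s z≤n)))

weight-zero : ∀ h → weight h 0 ≡ 0
weight-zero zero    = refl
weight-zero (suc h) = trans (weight-0+3* h 0 refl) (weight-zero h)

carry : ∀ r q t → r + q * 3 + 3 * t ≡ r + (q + t) * 3
carry = solve-∀

carry-* : ∀ r q k t → r + q * 3 + k * (3 * t) ≡ r + (q + k * t) * 3
carry-* = solve-∀

carry-leading : ∀ t r q → 3 * t + (r + q * 3) ≡ r + (t + q) * 3
carry-leading = solve-∀

weight-periodic : ∀ h k x → weight h (x + k * 3 ^ h) ≡ weight h x
weight-periodic zero    k x = refl
weight-periodic (suc h) k x with ternary x
... | 0+3* q = trans (weight-0+3* h _ (carry-* 0 q k (3 ^ h)))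
                     (trans (weight-periodic h k q) (sym (weight-0+3* h q refl)))
... | 1+3* q = trans (weight-1+3* h _ (carry-* 1 q k (3 ^ h)))
                     (trans (cong suc (weight-periodic h k q)) (sym (weight-1+3* h q refl)))
... | 2+3* q = trans (weight-2+3* h _ (carry-* 2 q k (3 ^ h)))
                     (trans (cong suc (weight-periodic h k (suc q))) (sym (weight-2+3* h q refl)))

weight-resp-≡mod : ∀ {h x y} → x ≡ y [mod 3 ^ h ] → weight h x ≡ weight h y
weight-resp-≡mod {h} {y = y} (k , inj₁ refl) = weight-periodic h k y
weight-resp-≡mod {h} {x}     (k , inj₂ refl) = sym (weight-periodic h k x)

infix 4 _≈₁_
_≈₁_ : ℕ → ℕ → Set
a ≈₁ b = a ≤ suc b × b ≤ suc a

≈₁-sym : ∀ {a b} → a ≈₁ b → b ≈₁ a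
≈₁-sym (a≤ , b≤) = b≤ , a≤

≈₁-suc : ∀ {a b} → a ≈₁ b → suc a ≈₁ suc b
≈₁-suc (a≤ , b≤) = s≤s a≤ , s≤s b≤

n≈₁1+n : ∀ n → n ≈₁ suc n
n≈₁1+n n = m≤n⇒m≤1+n (n≤1+n n) , ≤-refl

≈₁-resp : ∀ {a a′ b b′} → a ≡ a′ → b ≡ b′ → a′ ≈₁ b′ → a ≈₁ b
≈₁-resp refl refl a′≈b′ = a′≈b′

weight-+3^ : ∀ h i x → weight h (x + 3 ^ i) ≈₁ weight h x
weight-+3^ zero    i       x = z≤n , z≤n
weight-+3^ (suc h) zero    x with ternary x
... | 0+3* q = ≈₁-resp (weight-1+3* h q (+-comm (q * 3) 1)) (weight-0+3* h q refl)
                       (≈₁-sym (n≈₁1+n (weight h q)))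
... | 1+3* q = ≈₁-resp (weight-2+3* h q (+-comm (1 + q * 3) 1)) (weight-1+3* h q refl)
                       (≈₁-suc (≈₁-resp (cong (weight h) (+-comm 1 q)) refl (weight-+3^ h 0 q)))
... | 2+3* q = ≈₁-resp (weight-0+3* h (suc q) (+-comm (2 + q * 3) 1)) (weight-2+3* h q refl)
                       (n≈₁1+n (weight h (suc q)))
weight-+3^ (suc h) (suc i) x with ternary x
... | 0+3* q = ≈₁-resp (weight-0+3* h _ (carry 0 q (3 ^ i))) (weight-0+3* h q refl)
                       (weight-+3^ h i q)
... | 1+3* q = ≈₁-resp (weight-1+3* h _ (carry 1 q (3 ^ i))) (weight-1+3* h q refl)
                       (≈₁-suc (weight-+3^ h i q))
... | 2+3* q = ≈₁-resp (weight-2+3* h _ (carry 2 q (3 ^ i))) (weight-2+3* h q refl)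
                       (≈₁-suc (weight-+3^ h i (suc q)))

weight-Adj : ∀ {h u t} → Adj 3 h u t → weight h u ≈₁ weight h t
weight-Adj {h} {t = t} (_ , i , _ , inj₁ u≡t+3^i) =
  ≈₁-resp (weight-resp-≡mod {h} u≡t+3^i) refl (weight-+3^ h i t)
weight-Adj {h} {u}     (_ , i , _ , inj₂ t≡u+3^i) =
  ≈₁-sym (≈₁-resp (weight-resp-≡mod {h} t≡u+3^i) refl (weight-+3^ h i u))

weight-≤-Walk : ∀ {h u v ℓ} → Walk 3 h u v ℓ → weight h v ≤ weight h u + ℓ
weight-≤-Walk {h} {u} (here u≡v) =
  ≤-reflexive (trans (sym (weight-resp-≡mod {h} u≡v)) (sym (+-identityʳ (weight h u))))
weight-≤-Walk {h} {u} {v} {suc ℓ} (step {w = t} u~t t⇝v) = begin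
  weight h v           ≤⟨ weight-≤-Walk t⇝v ⟩
  weight h t + ℓ       ≤⟨ +-monoˡ-≤ ℓ (proj₂ (weight-Adj u~t)) ⟩
  suc (weight h u) + ℓ ≡⟨ +-suc (weight h u) ℓ ⟨
  weight h u + suc ℓ   ∎
  where open ≤-Reasoning

Adj-respˡ-≡mod : ∀ {h u u′ t} → u ≡ u′ [mod 3 ^ h ] → Adj 3 h u t → Adj 3 h u′ t
Adj-respˡ-≡mod {h} {u} {u′} {t} u≡u′ (u≢t , i , i<h , u~t) = u′≢t , i , i<h , moved u~t
  where
  instance
    3^h≢0 : NonZero (3 ^ h)
    3^h≢0 = m^n≢0 3 h

  u′≢t : ¬ (u′ ≡ t [mod 3 ^ h ])
  u′≢t u′≡t = u≢t (≡mod-trans _ u≡u′ u′≡t)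

  moved : u ≡ t + 3 ^ i [mod 3 ^ h ] ⊎ t ≡ u + 3 ^ i [mod 3 ^ h ] →
          u′ ≡ t + 3 ^ i [mod 3 ^ h ] ⊎ t ≡ u′ + 3 ^ i [mod 3 ^ h ]
  moved (inj₁ u≡t+3^i) = inj₁ (≡mod-trans _ (≡mod-sym u≡u′) u≡t+3^i)
  moved (inj₂ t≡u+3^i) = inj₂ (≡mod-trans _ t≡u+3^i (+-congʳ-≡mod _ (3 ^ i) u≡u′))

Walk-snoc : ∀ {h u v t ℓ} → Walk 3 h u v ℓ → Adj 3 h v t → Walk 3 h u t (suc ℓ)
Walk-snoc (here u≡v)    v~t = step (Adj-respˡ-≡mod (≡mod-sym u≡v) v~t) (here (≡mod-refl refl))
Walk-snoc (step u~w w⇝v) v~t = step u~w (Walk-snoc w⇝v v~t)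

Adj-*3 : ∀ {h u t} → Adj 3 h u t → Adj 3 (suc h) (u * 3) (t * 3)
Adj-*3 {h} {u} {t} (u≢t , i , i<h , u~t) =
  (λ 3u≡3t → u≢t (*3-cancel-≡mod 3u≡3t)) , suc i , s≤s i<h , scaled u~t
  where
  scaled : u ≡ t + 3 ^ i [mod 3 ^ h ] ⊎ t ≡ u + 3 ^ i [mod 3 ^ h ] →
           (u * 3) ≡ t * 3 + 3 ^ suc i [mod 3 ^ suc h ] ⊎ (t * 3) ≡ u * 3 + 3 ^ suc i [mod 3 ^ suc h ]
  scaled (inj₁ u≡t+3^i) = inj₁ (subst (λ y → (u * 3) ≡ y [mod 3 ^ suc h ]) (sym (carry 0 t (3 ^ i))) (*3-cong-≡mod u≡t+3^i))
  scaled (inj₂ t≡u+3^i) = inj₂ (subst (λ y → (t * 3) ≡ y [mod 3 ^ suc h ]) (sym (carry 0 u (3 ^ i))) (*3-cong-≡mod t≡u+3^i))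

Walk-*3 : ∀ {h u v ℓ} → Walk 3 h u v ℓ → Walk 3 (suc h) (u * 3) (v * 3) ℓ
Walk-*3 (here u≡v)     = here (*3-cong-≡mod u≡v)
Walk-*3 (step u~w w⇝v) = step (Adj-*3 u~w) (Walk-*3 w⇝v)

2≤3^[1+h] : ∀ h → 2 ≤ 3 ^ suc h
2≤3^[1+h] h = ≤-trans (n≤1+n 2) (*-monoʳ-≤ 3 (m^n>0 3 h))

Adj-suc : ∀ h u → Adj 3 (suc h) u (suc u)
Adj-suc h u = (λ u≡1+u → suc≢mod (2≤3^[1+h] h) (≡mod-sym u≡1+u)) , 0 , s≤s z≤n , inj₂ (≡mod-refl (+-comm 1 u))

Adj-pred : ∀ h u → Adj 3 (suc h) (suc u) u
Adj-pred h u = suc≢mod (2≤3^[1+h] h) , 0 , s≤s z≤n , inj₁ (≡mod-refl (+-comm 1 u))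

Walk-weight : ∀ h x → Walk 3 h 0 x (weight h x)
Walk-weight zero    x = here (x , inj₂ (sym (*-identityʳ x)))
Walk-weight (suc h) x with ternary x
... | 0+3* q = subst (Walk 3 (suc h) 0 (q * 3)) (sym (weight-0+3* h q refl))
                     (Walk-*3 (Walk-weight h q))
... | 1+3* q = subst (Walk 3 (suc h) 0 (1 + q * 3)) (sym (weight-1+3* h q refl))
                     (Walk-snoc (Walk-*3 (Walk-weight h q)) (Adj-suc h (q * 3)))
... | 2+3* q = subst (Walk 3 (suc h) 0 (2 + q * 3)) (sym (weight-2+3* h q refl))
                     (Walk-snoc (Walk-*3 (Walk-weight h (suc q))) (Adj-pred h (2 + q * 3)))

weight-IsDist : ∀ {h x d} → weight h x ≡ d → IsDist 3 h 0 x d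
weight-IsDist {h} {x} refl = Walk-weight h x , λ ℓ 0⇝x →
  subst (λ w₀ → weight h x ≤ w₀ + ℓ) (weight-zero h) (weight-≤-Walk 0⇝x)

-- (3^H − 1)/2, written 11…1 in base 3.
repunit : ℕ → ℕ
repunit zero    = 0
repunit (suc H) = suc (repunit H * 3)

3^≡1+repunit*2 : ∀ H → 3 ^ H ≡ suc (repunit H * 2)
3^≡1+repunit*2 zero    = refl
3^≡1+repunit*2 (suc H) = trans (cong (3 *_) (3^≡1+repunit*2 H)) (triple (repunit H))
  where
  triple : ∀ m → 3 * suc (m * 2) ≡ suc (suc (m * 3) * 2)
  triple = solve-∀

[3^∸1]/2≡repunit : ∀ H → (3 ^ H ∸ 1) / 2 ≡ repunit H
[3^∸1]/2≡repunit H = trans (cong (λ n → (n ∸ 1) / 2) (3^≡1+repunit*2 H)) (m*n/n≡m (repunit H) 2)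

weight-suc-≤repunit : ∀ H j → j ≤ repunit H → weight (suc H) j ≡ weight H j
weight-suc-≤repunit zero    zero _ = refl
weight-suc-≤repunit (suc H) j j≤ with ternary j
... | 0+3* q = trans (weight-0+3* (suc H) q refl)
                     (trans (weight-suc-≤repunit H q (quotient-mono 0 q _ (m≤n⇒m≤1+n j≤)))
                            (sym (weight-0+3* H q refl)))
... | 1+3* q = trans (weight-1+3* (suc H) q refl)
                     (trans (cong suc (weight-suc-≤repunit H q (quotient-mono 1 q _ (m≤n⇒m≤1+n j≤))))
                            (sym (weight-1+3* H q refl)))
... | 2+3* q = trans (weight-2+3* (suc H) q refl)
                     (trans (cong suc (weight-suc-≤repunit H (suc q) (quotient-mono 0 (suc q) _ (s≤s j≤))))
                            (sym (weight-2+3* H q refl)))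

weight-suc->repunit : ∀ H j → repunit H < j → j ≤ 3 ^ H → weight (suc H) j ≡ suc (weight H j)
weight-suc->repunit zero    (suc zero)    _ _         = refl
weight-suc->repunit zero    (suc (suc j)) _ (s≤s ())
weight-suc->repunit (suc H) j <j j≤ with ternary j | ≤-trans j≤ (≤-reflexive (*-comm 3 (3 ^ H)))
... | 0+3* q | j≤′ =
  trans (weight-0+3* (suc H) q refl)
        (trans (weight-suc->repunit H q (quotient-mono 0 (suc (repunit H)) q (m≤n⇒m≤1+n (s≤s <j)))
                                        (quotient-mono 0 q _ (≤-trans j≤′ (m≤n+m _ 2))))
               (cong suc (sym (weight-0+3* H q refl))))
... | 1+3* q | j≤′ =
  trans (weight-1+3* (suc H) q refl)
        (trans (cong suc (weight-suc->repunit H q (quotient-mono 0 (suc (repunit H)) q (s≤s <j))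
                                                 (quotient-mono 1 q _ (≤-trans j≤′ (m≤n+m _ 2)))))
               (cong suc (sym (weight-1+3* H q refl))))
... | 2+3* q | j≤′ =
  trans (weight-2+3* (suc H) q refl)
        (trans (cong suc (weight-suc->repunit H (suc q) (s≤s (quotient-mono 2 (repunit H) q <j))
                                                       (quotient-mono 0 (suc q) _ (m≤n⇒m≤1+n (s≤s j≤′)))))
               (cong suc (sym (weight-2+3* H q refl))))

weight-suc-3^+ : ∀ H j → j ≤ repunit H → weight (suc H) (3 ^ H + j) ≡ suc (weight H j)
weight-suc-3^+ zero    zero _ = refl
weight-suc-3^+ (suc H) j j≤ with ternary j
... | 0+3* q = trans (weight-0+3* (suc H) (3 ^ H + q) (carry-leading (3 ^ H) 0 q))
                     (trans (weight-suc-3^+ H q (quotient-mono 0 q _ (m≤n⇒m≤1+n j≤)))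
                            (cong suc (sym (weight-0+3* H q refl))))
... | 1+3* q = trans (weight-1+3* (suc H) (3 ^ H + q) (carry-leading (3 ^ H) 1 q))
                     (trans (cong suc (weight-suc-3^+ H q (quotient-mono 1 q _ (m≤n⇒m≤1+n j≤))))
                            (cong suc (sym (weight-1+3* H q refl))))
... | 2+3* q = trans (weight-2+3* (suc H) (3 ^ H + q) (carry-leading (3 ^ H) 2 q))
                     (trans (cong (λ n → suc (weight (suc H) n)) (sym (+-suc (3 ^ H) q)))
                            (trans (cong suc (weight-suc-3^+ H (suc q) (quotient-mono 0 (suc q) _ (s≤s j≤))))
                                   (cong suc (sym (weight-2+3* H q refl)))))

theorem3p14 : (h : ℕ) → 1 ≤ h →
    ((j : ℕ) → j ≤ (3 ^ (h ∸ 1) ∸ 1) / 2 →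
      ∃[ d ] (IsDist 3 (h ∸ 1) 0 j d × IsDist 3 h 0 j d))
    × ((j : ℕ) → (3 ^ (h ∸ 1) ∸ 1) / 2 + 1 ≤ j → j ≤ 3 ^ (h ∸ 1) ∸ 1 →
      ∃[ d ] (IsDist 3 (h ∸ 1) 0 j d × IsDist 3 h 0 j (suc d)))
    × ((j : ℕ) → j ≤ (3 ^ (h ∸ 1) ∸ 1) / 2 →
      ∃[ d ] (IsDist 3 (h ∸ 1) 0 j d × IsDist 3 h 0 (3 ^ (h ∸ 1) + j) (suc d)))
theorem3p14 zero    ()
theorem3p14 (suc H) _ =
  (λ j j≤ → weight H j , weight-IsDist refl , weight-IsDist (weight-suc-≤repunit H j (≤repunit j≤))) ,
  (λ j <j j≤ → weight H j , weight-IsDist refl ,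
     weight-IsDist (weight-suc->repunit H j (<repunit <j) (≤-trans j≤ (m∸n≤m (3 ^ H) 1)))) ,
  (λ j j≤ → weight H j , weight-IsDist refl , weight-IsDist (weight-suc-3^+ H j (≤repunit j≤)))
  where
  ≤repunit : ∀ {j} → j ≤ (3 ^ H ∸ 1) / 2 → j ≤ repunit H
  ≤repunit = subst (_ ≤_) ([3^∸1]/2≡repunit H)

  <repunit : ∀ {j} → (3 ^ H ∸ 1) / 2 + 1 ≤ j → repunit H < j
  <repunit {j} = subst (_≤ j) (trans (cong (_+ 1) ([3^∸1]/2≡repunit H)) (+-comm (repunit H) 1))
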